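{- Let $G$ be a finite simple connected graph on $n$ vertices and let $\alpha\in[0,1)$ be rational. Suppose $U\in\Gamma_\alpha(G)$ has level $l$ and $p$ is a prime dividing $l$. Then for each integer $k\geqslant 0$ there exists an integral column vector $\mathbf v\not\equiv\mathbf 0\pmod p$ such that $\mathbf v^TA_{c_\alpha}(G)^k\mathbf v\equiv 0\pmod{p^2}$ and $\tilde W_\alpha(G)^T\mathbf v\equiv\mathbf 0\pmod p$.
   Context: For a graph $G$ on $n$ vertices, $A(G)$ is its adjacency matrix, $D(G)$ its diagonal degree matrix, $A_\alpha(G)=\alpha D(G)+(1-\alpha)A(G)$. For rational $\alpha\in[0,1)$, $c_\alpha$ is the smallest positive integer such that $c_\alpha\alpha$ and $c_\alpha(1-\alpha)$ are integers, and $A_{c_\alpha}(G)=c_\alpha A_\alpha(G)$. $\mathbf 1$ is the all-ones vector and $\tilde W_\alpha(G)=\left[\mathbf 1,\frac{A_{c_\alpha}(G)\mathbf 1}{c_\alpha},\dots,\frac{A_{c_\alpha}(G)^{n-1}\mathbf 1}{c_\alpha}\right]$ (an integral matrix). $O_n(\mathbb Q)$ is the set of $n\times n$ rational orthogonal matrices and $\Gamma_\alpha(G)=\{U\in O_n(\mathbb Q): U\mathbf 1=\mathbf 1,\ U^TA_{c_\alpha}(G)U=A_{c_\alpha}(H)\text{ for some graph }H\}$ (graphs are finite, simple, undirected). The level of a rational orthogonal matrix $U$ is the smallest positive integer $k$ such that $kU$ is integral. -}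

module Defs where

open import Data.Nat as ℕ using (ℕ; zero; suc)
open import Data.Integer as ℤ using (ℤ; +_)
open import Data.Rational as ℚ using (ℚ; 0ℚ; 1ℚ; _/_; _+_; _*_; _-_; _≤_; _<_)
open import Data.Fin using (Fin; zero; suc; _≟_)
open import Data.Bool using (Bool; true; false; if_then_else_)
open import Data.Product using (Σ; ∃; _×_; _,_)
open import Relation.Binary.PropositionalEquality using (_≡_)
open import Relation.Nullary using (¬_; does)

ι : ℤ → ℚ
ι z = z / 1

ιℕ : ℕ → ℚ
ιℕ k = ι (+ k)

IsInt : ℚ → Set
IsInt q = ∃ λ (z : ℤ) → q ≡ ι z

Σ[<_]_ : (n : ℕ) → (Fin n → ℚ) → ℚ
Σ[< zero ] f = 0ℚ
Σ[< suc n ] f = f zero + Σ[< n ] (λ i → f (suc i))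

Mat : ℕ → Set
Mat n = Fin n → Fin n → ℚ

Vecℚ : ℕ → Set
Vecℚ n = Fin n → ℚ

δ : ∀ {n} → Fin n → Fin n → ℚ
δ i j = if does (i ≟ j) then 1ℚ else 0ℚ

idM : ∀ {n} → Mat n
idM = δ

_⊗_ : ∀ {n} → Mat n → Mat n → Mat n
_⊗_ {n} M N i j = Σ[< n ] (λ k → M i k * N k j)

_ᵀ : ∀ {n} → Mat n → Mat n
(M ᵀ) i j = M j i

_·v_ : ∀ {n} → Mat n → Vecℚ n → Vecℚ n
_·v_ {n} M v i = Σ[< n ] (λ k → M i k * v k)

dot : ∀ {n} → Vecℚ n → Vecℚ n → ℚ
dot {n} u v = Σ[< n ] (λ k → u k * v k)

_^M_ : ∀ {n} → Mat n → ℕ → Mat n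
M ^M zero = idM
M ^M suc k = M ⊗ (M ^M k)

ones : ∀ {n} → Vecℚ n
ones _ = 1ℚ

scaleM : ∀ {n} → ℚ → Mat n → Mat n
scaleM c M i j = c * M i j

IsIntMat : ∀ {n} → Mat n → Set
IsIntMat M = ∀ i j → IsInt (M i j)

IsOrthogonal : ∀ {n} → Mat n → Set
IsOrthogonal U = (U ᵀ) ⊗ U ≡ idM

IsLevel : ∀ {n} → Mat n → ℕ → Set
IsLevel U l =
  1 ℕ.≤ l × IsIntMat (scaleM (ιℕ l) U) ×
  (∀ m → 1 ℕ.≤ m → IsIntMat (scaleM (ιℕ m) U) → l ℕ.≤ m)

record Graph (n : ℕ) : Set where
  field
    adj   : Fin n → Fin n → Bool
    sym   : ∀ i j → adj i j ≡ adj j i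
    irrefl : ∀ i → adj i i ≡ false
open Graph public

data Reach {n} (G : Graph n) : Fin n → Fin n → Set where
  here : ∀ {i} → Reach G i i
  step : ∀ {i j k} → adj G i j ≡ true → Reach G j k → Reach G i k

Connected : ∀ {n} → Graph n → Set
Connected {n} G = ∀ (i j : Fin n) → Reach G i j

b2q : Bool → ℚ
b2q true = 1ℚ
b2q false = 0ℚ

A : ∀ {n} → Graph n → Mat n
A G i j = b2q (adj G i j)

deg : ∀ {n} → Graph n → Fin n → ℚ
deg {n} G i = Σ[< n ] (λ j → A G i j)

D : ∀ {n} → Graph n → Mat n
D G i j = δ i j * deg G i

Aα : ∀ {n} → ℚ → Graph n → Mat n
Aα α G i j = α * D G i j + (1ℚ - α) * A G i j

IsCα : ℚ → ℕ → Set
IsCα α c =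
  1 ℕ.≤ c × IsInt (ιℕ c * α) × IsInt (ιℕ c * (1ℚ - α)) ×
  (∀ m → 1 ℕ.≤ m → IsInt (ιℕ m * α) → IsInt (ιℕ m * (1ℚ - α)) → c ℕ.≤ m)

Ac : ∀ {n} → ℚ → ℕ → Graph n → Mat n
Ac α c G = scaleM (ιℕ c) (Aα α G)

-- 1/c for c ≥ 1 (value at 0 irrelevant; only used with c = c_α ≥ 1)
inv : ℕ → ℚ
inv zero = 0ℚ
inv (suc m) = + 1 / suc m

-- column j of W̃_α(G): 1 for j = 0, A_{c_α}(G)^j 1 / c_α for j ≥ 1
Wcol : ∀ {n} → ℚ → ℕ → Graph n → ℕ → Vecℚ n
Wcol α c G zero = ones
Wcol α c G (suc j) i = ((Ac α c G ^M suc j) ·v ones) i * inv c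

_∣ℚ_ : ℕ → ℚ → Set
m ∣ℚ x = ∃ λ (z : ℤ) → x ≡ ιℕ m * ι z

toℚv : ∀ {n} → (Fin n → ℤ) → Vecℚ n
toℚv v i = ι (v i)

-- Choose a column of the integral matrix l·U that is not ≡ 0 (mod p); one exists, since
-- otherwise (l/p)·U would be integral. Take v to be that column, v = l·U eᵢ. As U is
-- orthogonal, C := A_{c_α}(H) = Uᵀ A_{c_α}(G) U gives A_{c_α}(G) U = U C, hence
-- vᵀ A_{c_α}(G)ᵏ v = l² (Cᵏ)ᵢᵢ, and C is integral, so p² divides it. Since U 1 = 1 the
-- same intertwining gives Uᵀ W̃_α(G) = W̃_α(H), so W̃_α(G)ᵀ v = l·(row i of W̃_α(H)),
-- which is divisible by p because C 1 = c_α·(degrees of H) makes W̃_α(H) integral.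
-- The only linear algebra needed is that a left inverse over ℚ is a right inverse,
-- which follows from Gaussian elimination.

module Submission where

open import Defs
open import Data.Nat using (ℕ; _^_; _<_)
open import Data.Nat.Divisibility using (_∣_)
open import Data.Nat.Primality using (Prime)
open import Data.Integer using (ℤ; +_)
open import Data.Integer.Divisibility renaming (_∣_ to _∣ℤ_)
open import Data.Rational using (ℚ; 0ℚ; 1ℚ) renaming (_≤_ to _≤ℚ_; _<_ to _<ℚ_)
open import Data.Fin using (Fin)
open import Data.Product using (∃; _×_)
open import Relation.Binary.PropositionalEquality using (_≡_)
open import Relation.Nullary using (¬_)

open import Data.Nat using (zero; suc)
import Data.Nat as ℕ
import Data.Nat.Properties as ℕP
import Data.Nat.Divisibility as ℕD
open import Data.Nat.Primality using (prime⇒nonTrivial)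
open import Data.Nat.Coprimality using (1-coprimeTo) renaming (sym to coprime-sym)
import Data.Integer as ℤ
import Data.Integer.Properties as ℤP
import Data.Integer.Divisibility.Signed as ℤS
open import Data.Rational using (_+_; _*_; -_; _-_; mkℚ; ↥_; 1/_; NonZero; ≢-nonZero)
import Data.Rational.Properties as ℚP
open import Data.Rational.Solver using (module +-*-Solver)
open +-*-Solver
open import Data.Fin using (zero; suc; punchIn)
import Data.Fin.Properties as FinP
open import Data.Vec.Functional using (_∷_; insertAt)
open import Data.Vec.Functional.Properties using (insertAt-lookup; insertAt-punchIn)
open import Data.Product using (_,_; proj₁; proj₂)
open import Data.Bool using (true; false)
open import Data.Empty using (⊥; ⊥-elim)
open import Function using (_∘_)
open import Relation.Nullary using (Dec; yes; no)
open import Relation.Nullary.Decidable using (¬?)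
open import Relation.Binary.Bundles using (Setoid)
open import Relation.Binary.PropositionalEquality
  using (refl; trans; cong; cong₂; subst; _≗_; module ≡-Reasoning)
  renaming (sym to ≡-sym)
import Relation.Binary.Reasoning.Setoid as SetoidReasoning
open import Algebra.Properties.Group ℚP.+-0-group using () renaming (inverseʳ-unique to +-inverseʳ-unique)

ι≡mkℚ : ∀ z → ι z ≡ mkℚ z 0 (coprime-sym (1-coprimeTo _))
ι≡mkℚ z = ℚP.↥p/↧p≡p (mkℚ z 0 (coprime-sym (1-coprimeTo _)))

ι-+ : ∀ a b → ι (a ℤ.+ b) ≡ ι a + ι b
ι-+ a b rewrite ι≡mkℚ a | ι≡mkℚ b | ℤP.*-identityʳ a | ℤP.*-identityʳ b = refl

ι-* : ∀ a b → ι (a ℤ.* b) ≡ ι a * ι b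
ι-* a b rewrite ι≡mkℚ a | ι≡mkℚ b = refl

ι-injective : ∀ {a b} → ι a ≡ ι b → a ≡ b
ι-injective {a} {b} e = cong ↥_ (trans (≡-sym (ι≡mkℚ a)) (trans e (ι≡mkℚ b)))

ιℕ-* : ∀ a b → ιℕ (a ℕ.* b) ≡ ιℕ a * ιℕ b
ιℕ-* a b = trans (cong ι (ℤP.pos-* a b)) (ι-* (+ a) (+ b))

inv-* : ∀ c → 1 ℕ.≤ c → inv c * ιℕ c ≡ 1ℚ
inv-* (suc c) _ = begin
  inv (suc c) * ιℕ (suc c)  ≡⟨ cong₂ _*_ (ℚP.↥p/↧p≡p (mkℚ (+ 1) c (1-coprimeTo _))) (ι≡mkℚ (+ suc c)) ⟩
  1/ r * r                  ≡⟨ ℚP.*-inverseˡ r ⟩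
  1ℚ                        ∎
  where
  open ≡-Reasoning
  r = mkℚ (+ suc c) 0 (coprime-sym (1-coprimeTo _))

*-cancelʳ : ∀ {x y z : ℚ} → ¬ (z ≡ 0ℚ) → x * z ≡ y * z → x ≡ y
*-cancelʳ {x} {y} {z} z≢0 e = begin
  x                ≡⟨ ≡-sym (ℚP.*-identityʳ x) ⟩
  x * 1ℚ           ≡⟨ cong (x *_) (≡-sym z*z⁻¹≡1) ⟩
  x * (z * 1/ z)   ≡⟨ ≡-sym (ℚP.*-assoc x z (1/ z)) ⟩
  (x * z) * 1/ z   ≡⟨ cong (_* 1/ z) e ⟩
  (y * z) * 1/ z   ≡⟨ ℚP.*-assoc y z (1/ z) ⟩
  y * (z * 1/ z)   ≡⟨ cong (y *_) z*z⁻¹≡1 ⟩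
  y * 1ℚ           ≡⟨ ℚP.*-identityʳ y ⟩
  y                ∎
  where
  open ≡-Reasoning
  instance
    _ : NonZero z
    _ = ≢-nonZero z≢0
  z*z⁻¹≡1 : z * 1/ z ≡ 1ℚ
  z*z⁻¹≡1 = ℚP.*-inverseʳ z

Σ-cong : ∀ n {f g : Fin n → ℚ} → f ≗ g → Σ[< n ] f ≡ Σ[< n ] g
Σ-cong zero    e = refl
Σ-cong (suc n) e = cong₂ _+_ (e zero) (Σ-cong n (e ∘ suc))

Σ-zero : ∀ n → Σ[< n ] (λ _ → 0ℚ) ≡ 0ℚ
Σ-zero zero    = refl
Σ-zero (suc n) = trans (cong (_+_ 0ℚ) (Σ-zero n)) (ℚP.+-identityˡ 0ℚ)

Σ-+ : ∀ n (f g : Fin n → ℚ) → Σ[< n ] (λ i → f i + g i) ≡ Σ[< n ] f + Σ[< n ] g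
Σ-+ zero    f g = refl
Σ-+ (suc n) f g = trans (cong (_+_ (f zero + g zero)) (Σ-+ n (f ∘ suc) (g ∘ suc)))
  (solve 4 (λ a b c d → (a :+ b) :+ (c :+ d) := (a :+ c) :+ (b :+ d)) refl (f zero) (g zero) _ _)

Σ-*ˡ : ∀ n c (f : Fin n → ℚ) → c * Σ[< n ] f ≡ Σ[< n ] (λ i → c * f i)
Σ-*ˡ zero    c f = ℚP.*-zeroʳ c
Σ-*ˡ (suc n) c f = trans (ℚP.*-distribˡ-+ c (f zero) _) (cong (_+_ (c * f zero)) (Σ-*ˡ n c (f ∘ suc)))

Σ-*ʳ : ∀ n c (f : Fin n → ℚ) → Σ[< n ] f * c ≡ Σ[< n ] (λ i → f i * c)
Σ-*ʳ n c f = trans (ℚP.*-comm _ c) (trans (Σ-*ˡ n c f) (Σ-cong n (λ i → ℚP.*-comm c (f i))))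

Σ-linear : ∀ n a b (f g : Fin n → ℚ) →
  Σ[< n ] (λ i → a * f i + b * g i) ≡ a * Σ[< n ] f + b * Σ[< n ] g
Σ-linear n a b f g = trans (Σ-+ n _ _) (≡-sym (cong₂ _+_ (Σ-*ˡ n a f) (Σ-*ˡ n b g)))

Σ-swap : ∀ m n (f : Fin m → Fin n → ℚ) →
  Σ[< m ] (λ i → Σ[< n ] (f i)) ≡ Σ[< n ] (λ j → Σ[< m ] (λ i → f i j))
Σ-swap zero    n f = ≡-sym (Σ-zero n)
Σ-swap (suc m) n f = trans (cong (_+_ (Σ[< n ] (f zero))) (Σ-swap m n (f ∘ suc)))
  (≡-sym (Σ-+ n (f zero) _))

Σ-δˡ : ∀ n (i : Fin n) (f : Fin n → ℚ) → Σ[< n ] (λ k → δ i k * f k) ≡ f i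
Σ-δˡ (suc n) zero    f = trans
  (cong₂ _+_ (ℚP.*-identityˡ (f zero)) (trans (Σ-cong n (λ k → ℚP.*-zeroˡ (f (suc k)))) (Σ-zero n)))
  (ℚP.+-identityʳ _)
Σ-δˡ (suc n) (suc i) f = trans (cong₂ _+_ (ℚP.*-zeroˡ (f zero)) (Σ-δˡ n i (f ∘ suc))) (ℚP.+-identityˡ _)

δ-sym : ∀ {n} (i j : Fin n) → δ i j ≡ δ j i
δ-sym zero    zero    = refl
δ-sym zero    (suc j) = refl
δ-sym (suc i) zero    = refl
δ-sym (suc i) (suc j) = δ-sym i j

Σ-δʳ : ∀ n (j : Fin n) (f : Fin n → ℚ) → Σ[< n ] (λ k → f k * δ k j) ≡ f j
Σ-δʳ n j f = trans (Σ-cong n (λ k → trans (ℚP.*-comm (f k) _) (cong (_* f k) (δ-sym k j)))) (Σ-δˡ n j f)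

Σ-punchIn : ∀ m (a : Fin (suc m)) (f : Fin (suc m) → ℚ) →
  Σ[< suc m ] f ≡ f a + Σ[< m ] (f ∘ punchIn a)
Σ-punchIn m       zero    f = refl
Σ-punchIn (suc m) (suc a) f = trans (cong (_+_ (f zero)) (Σ-punchIn m a (f ∘ suc)))
  (solve 3 (λ x y z → x :+ (y :+ z) := y :+ (x :+ z)) refl (f zero) (f (suc a)) _)

infix 4 _≈M_
_≈M_ : ∀ {n} → Mat n → Mat n → Set
M ≈M N = ∀ i j → M i j ≡ N i j

≈M-refl : ∀ {n} {M : Mat n} → M ≈M M
≈M-refl i j = refl

≈M-sym : ∀ {n} {M N : Mat n} → M ≈M N → N ≈M M
≈M-sym e i j = ≡-sym (e i j)

≈M-trans : ∀ {n} {M N P : Mat n} → M ≈M N → N ≈M P → M ≈M P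
≈M-trans e e′ i j = trans (e i j) (e′ i j)

≈M-setoid : ℕ → Setoid _ _
≈M-setoid n = record
  { Carrier = Mat n
  ; _≈_ = _≈M_
  ; isEquivalence = record { refl = ≈M-refl ; sym = ≈M-sym ; trans = ≈M-trans }
  }

module MatReasoning {n : ℕ} = SetoidReasoning (≈M-setoid n)

≡⇒≈M : ∀ {n} {M N : Mat n} → M ≡ N → M ≈M N
≡⇒≈M refl = ≈M-refl

⊗-cong : ∀ {n} {M M′ N N′ : Mat n} → M ≈M M′ → N ≈M N′ → M ⊗ N ≈M M′ ⊗ N′
⊗-cong {n} e e′ i j = Σ-cong n (λ k → cong₂ _*_ (e i k) (e′ k j))

⊗-congˡ : ∀ {n} (M : Mat n) {N N′ : Mat n} → N ≈M N′ → M ⊗ N ≈M M ⊗ N′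
⊗-congˡ M = ⊗-cong (≈M-refl {M = M})

⊗-congʳ : ∀ {n} (N : Mat n) {M M′ : Mat n} → M ≈M M′ → M ⊗ N ≈M M′ ⊗ N
⊗-congʳ N e = ⊗-cong e (≈M-refl {M = N})

⊗-assoc : ∀ {n} (M N P : Mat n) → (M ⊗ N) ⊗ P ≈M M ⊗ (N ⊗ P)
⊗-assoc {n} M N P i j = begin
  Σ[< n ] (λ k → Σ[< n ] (λ l → M i l * N l k) * P k j)   ≡⟨ Σ-cong n (λ k → Σ-*ʳ n (P k j) _) ⟩
  Σ[< n ] (λ k → Σ[< n ] (λ l → M i l * N l k * P k j))   ≡⟨ Σ-swap n n _ ⟩
  Σ[< n ] (λ l → Σ[< n ] (λ k → M i l * N l k * P k j))   ≡⟨ Σ-cong n (λ l → Σ-cong n (λ k → ℚP.*-assoc (M i l) _ _)) ⟩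
  Σ[< n ] (λ l → Σ[< n ] (λ k → M i l * (N l k * P k j))) ≡⟨ Σ-cong n (λ l → ≡-sym (Σ-*ˡ n (M i l) _)) ⟩
  Σ[< n ] (λ l → M i l * Σ[< n ] (λ k → N l k * P k j))   ∎
  where open ≡-Reasoning

⊗-identityˡ : ∀ {n} (M : Mat n) → idM ⊗ M ≈M M
⊗-identityˡ {n} M i j = Σ-δˡ n i (λ k → M k j)

⊗-identityʳ : ∀ {n} (M : Mat n) → M ⊗ idM ≈M M
⊗-identityʳ {n} M i j = Σ-δʳ n j (M i)

^M-suc : ∀ {n} (M : Mat n) k → M ^M suc k ≈M (M ^M k) ⊗ M
^M-suc M zero    = ≈M-trans (⊗-identityʳ M) (≈M-sym (⊗-identityˡ M))
^M-suc M (suc k) = ≈M-trans (⊗-congˡ M (^M-suc M k))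
                                      (≈M-sym (⊗-assoc M (M ^M k) M))

·v-cong : ∀ {n} {M N : Mat n} {y z : Vecℚ n} → M ≈M N → y ≗ z → M ·v y ≗ N ·v z
·v-cong {n} e e′ i = Σ-cong n (λ k → cong₂ _*_ (e i k) (e′ k))

·v-congʳ : ∀ {n} (M : Mat n) {y z : Vecℚ n} → y ≗ z → M ·v y ≗ M ·v z
·v-congʳ {n} M e i = Σ-cong n (λ k → cong (M i k *_) (e k))

·v-assoc : ∀ {n} (M N : Mat n) (y : Vecℚ n) → M ·v (N ·v y) ≗ (M ⊗ N) ·v y
·v-assoc {n} M N y i = begin
  Σ[< n ] (λ k → M i k * Σ[< n ] (λ l → N k l * y l))   ≡⟨ Σ-cong n (λ k → Σ-*ˡ n (M i k) _) ⟩
  Σ[< n ] (λ k → Σ[< n ] (λ l → M i k * (N k l * y l))) ≡⟨ Σ-cong n (λ k → Σ-cong n (λ l → ≡-sym (ℚP.*-assoc (M i k) _ _))) ⟩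
  Σ[< n ] (λ k → Σ[< n ] (λ l → M i k * N k l * y l))   ≡⟨ Σ-swap n n _ ⟩
  Σ[< n ] (λ l → Σ[< n ] (λ k → M i k * N k l * y l))   ≡⟨ Σ-cong n (λ l → ≡-sym (Σ-*ʳ n (y l) _)) ⟩
  Σ[< n ] (λ l → Σ[< n ] (λ k → M i k * N k l) * y l)   ∎
  where open ≡-Reasoning

·v-identity : ∀ {n} (y : Vecℚ n) → idM ·v y ≗ y
·v-identity {n} y i = Σ-δˡ n i y

·v-scale : ∀ {n} (M : Mat n) c (y : Vecℚ n) → M ·v (λ j → c * y j) ≗ λ i → c * (M ·v y) i
·v-scale {n} M c y i = trans
  (Σ-cong n (λ k → solve 3 (λ a b d → a :* (b :* d) := b :* (a :* d)) refl (M i k) c (y k)))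
  (≡-sym (Σ-*ˡ n c _))

-- Linear algebra over ℚ

NonZeroVec : ∀ {m} → Vecℚ m → Set
NonZeroVec x = ∃ λ j → ¬ (x j ≡ 0ℚ)

NontrivialSolution : ∀ {n m} → (Fin n → Fin m → ℚ) → Set
NontrivialSolution {m = m} B = ∃ λ x → NonZeroVec x × ∀ i → Σ[< m ] (λ j → B i j * x j) ≡ 0ℚ

-- Cross-multiplied against the pivot row, so that no division is needed.
eliminate : ∀ {n m} → (Fin n → Fin (suc m) → ℚ) → Fin n → Fin (suc m) → Fin n → Fin m → ℚ
eliminate B i₀ a i j = B i₀ a * B i (punchIn a j) - B i a * B i₀ (punchIn a j)

eliminate-lift : ∀ n m (B : Fin (suc n) → Fin (suc m) → ℚ) (a : Fin (suc m)) → ¬ (B zero a ≡ 0ℚ) →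
  NontrivialSolution (eliminate B zero a ∘ suc) → NontrivialSolution B
eliminate-lift n m B a pivot≢0 (x′ , (j₀ , x′j₀≢0) , reduced) = x , x≢0 , solves
  where
  pivot = B zero a
  E = eliminate B zero a
  S = Σ[< m ] (λ j → B zero (punchIn a j) * x′ j)
  x′p : Vecℚ m
  x′p j = x′ j * pivot
  x = insertAt x′p a (- S)
  x≢0 : NonZeroVec x
  x≢0 = punchIn a j₀ , λ x≡0 → x′j₀≢0 (*-cancelʳ pivot≢0
    (trans (≡-sym (insertAt-punchIn x′p a (- S) j₀)) (trans x≡0 (≡-sym (ℚP.*-zeroˡ pivot)))))
  row-via-E : ∀ i → Σ[< suc m ] (λ j → B i j * x j) ≡ Σ[< m ] (λ j → E i j * x′ j)
  row-via-E i = begin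
    Σ[< suc m ] (λ j → B i j * x j)
      ≡⟨ Σ-punchIn m a (λ j → B i j * x j) ⟩
    B i a * x a + Σ[< m ] (λ j → B i (punchIn a j) * x (punchIn a j))
      ≡⟨ cong₂ (λ s t → B i a * s + t) (insertAt-lookup x′p a (- S))
               (Σ-cong m (λ j → cong (B i (punchIn a j) *_) (insertAt-punchIn x′p a (- S) j))) ⟩
    B i a * (- S) + Σ[< m ] (λ j → B i (punchIn a j) * (x′ j * pivot))
      ≡⟨ cong (_+_ (B i a * (- S))) (trans
           (Σ-cong m (λ j → solve 3 (λ b y p → b :* (y :* p) := p :* (b :* y)) refl (B i (punchIn a j)) (x′ j) pivot))
           (≡-sym (Σ-*ˡ m pivot _))) ⟩
    B i a * (- S) + pivot * T
      ≡⟨ solve 4 (λ b s p t → b :* (:- s) :+ p :* t := p :* t :+ (:- b) :* s) refl (B i a) S pivot T ⟩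
    pivot * T + (- B i a) * S
      ≡⟨ ≡-sym (Σ-linear m pivot (- B i a) _ _) ⟩
    Σ[< m ] (λ j → pivot * (B i (punchIn a j) * x′ j) + (- B i a) * (B zero (punchIn a j) * x′ j))
      ≡⟨ Σ-cong m (λ j → solve 5 (λ p b ba r y → p :* (b :* y) :+ (:- ba) :* (r :* y) := (p :* b :- ba :* r) :* y)
                         refl pivot (B i (punchIn a j)) (B i a) (B zero (punchIn a j)) (x′ j)) ⟩
    Σ[< m ] (λ j → E i j * x′ j)
      ∎
    where
    open ≡-Reasoning
    T = Σ[< m ] (λ j → B i (punchIn a j) * x′ j)
  solves : ∀ i → Σ[< suc m ] (λ j → B i j * x j) ≡ 0ℚ
  solves zero    = trans (row-via-E zero)
    (trans (Σ-cong m (λ j → solve 3 (λ p b y → (p :* b :- p :* b) :* y := con 0ℚ) refl pivot _ (x′ j)))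
           (Σ-zero m))
  solves (suc i) = trans (row-via-E (suc i)) (reduced i)

zero-row-lift : ∀ n m (B : Fin (suc n) → Fin m → ℚ) → (∀ j → B zero j ≡ 0ℚ) →
  NontrivialSolution (B ∘ suc) → NontrivialSolution B
zero-row-lift n m B first-row-zero (x , x≢0 , rest) = x , x≢0 , λ
  { zero    → trans (Σ-cong m (λ j → trans (cong (_* x j) (first-row-zero j)) (ℚP.*-zeroˡ (x j)))) (Σ-zero m)
  ; (suc i) → rest i
  }

homogeneous-nontrivial : ∀ n m → n < m → (B : Fin n → Fin m → ℚ) → NontrivialSolution B
homogeneous-nontrivial zero (suc m) _ B = (λ _ → 1ℚ) , (zero , ℚP.1≢0) , λ ()
homogeneous-nontrivial (suc n) (suc m) (ℕ.s≤s n<m) B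
  with FinP.any? (λ a → ¬? (B zero a ℚP.≟ 0ℚ))
... | yes (a , pivot≢0) =
  eliminate-lift n m B a pivot≢0 (homogeneous-nontrivial n m n<m (eliminate B zero a ∘ suc))
... | no no-pivot =
  zero-row-lift n (suc m) B first-row-zero (homogeneous-nontrivial n (suc m) (ℕP.m<n⇒m<1+n n<m) (B ∘ suc))
  where
  first-row-zero : ∀ j → B zero j ≡ 0ℚ
  first-row-zero j with B zero j ℚP.≟ 0ℚ
  ... | yes e = e
  ... | no ne = ⊥-elim (no-pivot (j , ne))

·v-left-inverse : ∀ {n} (L U : Mat n) → L ⊗ U ≈M idM → ∀ x → L ·v (U ·v x) ≗ x
·v-left-inverse L U L⊗U≈id x k =
  trans (·v-assoc L U x k) (trans (·v-cong L⊗U≈id (λ _ → refl) k) (·v-identity x k))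

module _ {n : ℕ} (L U : Mat n) (L⊗U≈id : L ⊗ U ≈M idM) where

  left-inverse⇒·v-injective : ∀ x → U ·v x ≗ (λ _ → 0ℚ) → x ≗ (λ _ → 0ℚ)
  left-inverse⇒·v-injective x Ux≡0 k = begin
    x k                              ≡⟨ ≡-sym (·v-left-inverse L U L⊗U≈id x k) ⟩
    (L ·v (U ·v x)) k                ≡⟨ ·v-congʳ L Ux≡0 k ⟩
    Σ[< n ] (λ l → L k l * 0ℚ)       ≡⟨ Σ-cong n (λ l → ℚP.*-zeroʳ (L k l)) ⟩
    Σ[< n ] (λ _ → 0ℚ)               ≡⟨ Σ-zero n ⟩
    0ℚ                               ∎
    where open ≡-Reasoning

  -- A nontrivial relation between y and the n columns of U must involve y,
  -- since the columns of U are independent.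
  left-inverse⇒·v-surjective : ∀ y → ∃ λ w → U ·v w ≗ y
  left-inverse⇒·v-surjective y = express (homogeneous-nontrivial n (suc n) (ℕP.n<1+n n) (λ i → y i ∷ U i))
    where
    express : NontrivialSolution (λ i → y i ∷ U i) → ∃ λ w → U ·v w ≗ y
    express (x , x≢0 , relates) with x zero ℚP.≟ 0ℚ
    ... | yes x₀≡0 = ⊥-elim (contra x≢0)
      where
      tail-zero : (x ∘ suc) ≗ (λ _ → 0ℚ)
      tail-zero = left-inverse⇒·v-injective (x ∘ suc) λ i → begin
        (U ·v (x ∘ suc)) i                     ≡⟨ ≡-sym (ℚP.+-identityˡ _) ⟩
        0ℚ + (U ·v (x ∘ suc)) i                ≡⟨ cong (_+ (U ·v (x ∘ suc)) i) (≡-sym (ℚP.*-zeroʳ (y i))) ⟩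
        y i * 0ℚ + (U ·v (x ∘ suc)) i          ≡⟨ cong (λ t → y i * t + (U ·v (x ∘ suc)) i) (≡-sym x₀≡0) ⟩
        y i * x zero + (U ·v (x ∘ suc)) i      ≡⟨ relates i ⟩
        0ℚ                                     ∎
        where open ≡-Reasoning
      contra : NonZeroVec x → ⊥
      contra (zero  , x₀≢0) = x₀≢0 x₀≡0
      contra (suc k , xₖ≢0) = xₖ≢0 (tail-zero k)
    ... | no x₀≢0 = w , Uw≡y
      where
      instance
        _ : NonZero (x zero)
        _ = ≢-nonZero x₀≢0
      w : Vecℚ n
      w k = (- 1/ x zero) * x (suc k)
      Uw≡y : U ·v w ≗ y
      Uw≡y i = begin
        (U ·v w) i                                  ≡⟨ ·v-scale U (- 1/ x zero) (x ∘ suc) i ⟩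
        (- 1/ x zero) * (U ·v (x ∘ suc)) i          ≡⟨ cong ((- 1/ x zero) *_) (+-inverseʳ-unique _ _ (relates i)) ⟩
        (- 1/ x zero) * (- (y i * x zero))          ≡⟨ solve 3 (λ a b c → (:- c) :* (:- (a :* b)) := a :* (b :* c)) refl (y i) (x zero) (1/ x zero) ⟩
        y i * (x zero * 1/ x zero)                  ≡⟨ cong (y i *_) (ℚP.*-inverseʳ (x zero)) ⟩
        y i * 1ℚ                                    ≡⟨ ℚP.*-identityʳ (y i) ⟩
        y i                                         ∎
        where open ≡-Reasoning

  left-inverse⇒right-inverse : U ⊗ L ≈M idM
  left-inverse⇒right-inverse i j = begin
    (U ⊗ L) i j                 ≡⟨ ·v-congʳ U (λ k → ≡-sym (Σ-δʳ n j (L k))) i ⟩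
    (U ·v (L ·v eⱼ)) i          ≡⟨ ·v-congʳ U (·v-congʳ L (λ k → ≡-sym (Uw≡eⱼ k))) i ⟩
    (U ·v (L ·v (U ·v w))) i    ≡⟨ ·v-congʳ U (·v-left-inverse L U L⊗U≈id w) i ⟩
    (U ·v w) i                  ≡⟨ Uw≡eⱼ i ⟩
    δ i j                       ∎
    where
    open ≡-Reasoning
    eⱼ : Vecℚ n
    eⱼ l = δ l j
    w = proj₁ (left-inverse⇒·v-surjective eⱼ)
    Uw≡eⱼ = proj₂ (left-inverse⇒·v-surjective eⱼ)

IsInt-cong : ∀ {a b} → a ≡ b → IsInt a → IsInt b
IsInt-cong refl h = h

IsInt-0 : IsInt 0ℚ
IsInt-0 = + 0 , refl

IsInt-1 : IsInt 1ℚ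
IsInt-1 = + 1 , refl

IsInt-+ : ∀ {a b} → IsInt a → IsInt b → IsInt (a + b)
IsInt-+ (x , refl) (y , refl) = x ℤ.+ y , ≡-sym (ι-+ x y)

IsInt-* : ∀ {a b} → IsInt a → IsInt b → IsInt (a * b)
IsInt-* (x , refl) (y , refl) = x ℤ.* y , ≡-sym (ι-* x y)

IsInt-Σ : ∀ n {f : Fin n → ℚ} → (∀ i → IsInt (f i)) → IsInt (Σ[< n ] f)
IsInt-Σ zero    h = IsInt-0
IsInt-Σ (suc n) h = IsInt-+ (h zero) (IsInt-Σ n (h ∘ suc))

IsInt-δ : ∀ {n} (i j : Fin n) → IsInt (δ i j)
IsInt-δ zero    zero    = IsInt-1
IsInt-δ zero    (suc j) = IsInt-0
IsInt-δ (suc i) zero    = IsInt-0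
IsInt-δ (suc i) (suc j) = IsInt-δ i j

IsInt-b2q : ∀ b → IsInt (b2q b)
IsInt-b2q true  = IsInt-1
IsInt-b2q false = IsInt-0

IsInt-deg : ∀ {n} (H : Graph n) i → IsInt (deg H i)
IsInt-deg {n} H i = IsInt-Σ n (λ j → IsInt-b2q (adj H i j))

IsInt-·v : ∀ {n} {M : Mat n} {y : Vecℚ n} → IsIntMat M → (∀ i → IsInt (y i)) → ∀ i → IsInt ((M ·v y) i)
IsInt-·v {n} hM hy i = IsInt-Σ n (λ k → IsInt-* (hM i k) (hy k))

IsIntMat-⊗ : ∀ {n} {M N : Mat n} → IsIntMat M → IsIntMat N → IsIntMat (M ⊗ N)
IsIntMat-⊗ {n} hM hN i j = IsInt-Σ n (λ k → IsInt-* (hM i k) (hN k j))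

IsIntMat-^M : ∀ {n} {M : Mat n} → IsIntMat M → ∀ k → IsIntMat (M ^M k)
IsIntMat-^M h zero    = IsInt-δ
IsIntMat-^M h (suc k) = IsIntMat-⊗ h (IsIntMat-^M h k)

Ac·ones : ∀ {n} α c (H : Graph n) → Ac α c H ·v ones ≗ λ i → ιℕ c * deg H i
Ac·ones {n} α c H i = begin
  Σ[< n ] (λ j → ιℕ c * (α * (δ i j * d) + (1ℚ - α) * A H i j) * 1ℚ)
    ≡⟨ Σ-cong n (λ j → solve 5 (λ c a b e f → (c :* (a :* e :+ b :* f)) :* con 1ℚ := (c :* a) :* e :+ (c :* b) :* f)
                       refl (ιℕ c) α (1ℚ - α) (δ i j * d) (A H i j)) ⟩
  Σ[< n ] (λ j → ιℕ c * α * (δ i j * d) + ιℕ c * (1ℚ - α) * A H i j)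
    ≡⟨ Σ-linear n (ιℕ c * α) (ιℕ c * (1ℚ - α)) _ _ ⟩
  ιℕ c * α * Σ[< n ] (λ j → δ i j * d) + ιℕ c * (1ℚ - α) * d
    ≡⟨ cong (λ t → ιℕ c * α * t + ιℕ c * (1ℚ - α) * d) (Σ-δˡ n i (λ _ → d)) ⟩
  ιℕ c * α * d + ιℕ c * (1ℚ - α) * d
    ≡⟨ solve 3 (λ c a d → c :* a :* d :+ c :* (con 1ℚ :- a) :* d := c :* d) refl (ιℕ c) α d ⟩
  ιℕ c * d
    ∎
  where
  open ≡-Reasoning
  d = deg H i

module _ {α : ℚ} {c : ℕ} (c-is-cα : IsCα α c) where

  Ac-integral : ∀ {n} (H : Graph n) → IsIntMat (Ac α c H)
  Ac-integral H i j = IsInt-cong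
    (solve 5 (λ c a b e f → (c :* a) :* e :+ (c :* b) :* f := c :* (a :* e :+ b :* f))
           refl (ιℕ c) α (1ℚ - α) (δ i j * deg H i) (A H i j))
    (IsInt-+ (IsInt-* cα-int (IsInt-* (IsInt-δ i j) (IsInt-deg H i)))
             (IsInt-* c[1-α]-int (IsInt-b2q (adj H i j))))
    where
    cα-int = proj₁ (proj₂ c-is-cα)
    c[1-α]-int = proj₁ (proj₂ (proj₂ c-is-cα))

  Wcol-integral : ∀ {n} (H : Graph n) j i → IsInt (Wcol α c H j i)
  Wcol-integral H zero    i = IsInt-1
  Wcol-integral H (suc j) i = IsInt-cong (≡-sym Wcol≡) (IsInt-·v (IsIntMat-^M (Ac-integral H) j) (IsInt-deg H) i)
    where
    open ≡-Reasoning
    C = Ac α c H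
    Wcol≡ : Wcol α c H (suc j) i ≡ ((C ^M j) ·v deg H) i
    Wcol≡ = begin
      ((C ^M suc j) ·v ones) i * inv c               ≡⟨ cong (_* inv c) (·v-cong (^M-suc C j) (λ _ → refl) i) ⟩
      (((C ^M j) ⊗ C) ·v ones) i * inv c             ≡⟨ cong (_* inv c) (≡-sym (·v-assoc (C ^M j) C ones i)) ⟩
      ((C ^M j) ·v (C ·v ones)) i * inv c            ≡⟨ cong (_* inv c) (·v-congʳ (C ^M j) (Ac·ones α c H) i) ⟩
      ((C ^M j) ·v (λ k → ιℕ c * deg H k)) i * inv c ≡⟨ cong (_* inv c) (·v-scale (C ^M j) (ιℕ c) (deg H) i) ⟩
      ιℕ c * X * inv c                               ≡⟨ solve 3 (λ c x i → c :* x :* i := x :* (i :* c)) refl (ιℕ c) X (inv c) ⟩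
      X * (inv c * ιℕ c)                             ≡⟨ cong (X *_) (inv-* c (proj₁ c-is-cα)) ⟩
      X * 1ℚ                                         ≡⟨ ℚP.*-identityʳ X ⟩
      X                                              ∎
      where X = ((C ^M j) ·v deg H) i

-- Conjugation by a matrix with a two-sided inverse

conjugate⇒intertwine : ∀ {n} (L U B C : Mat n) → U ⊗ L ≈M idM → (L ⊗ B) ⊗ U ≈M C → B ⊗ U ≈M U ⊗ C
conjugate⇒intertwine L U B C U⊗L≈id LBU≈C = begin
  B ⊗ U                ≈⟨ ⊗-identityˡ (B ⊗ U) ⟨
  idM ⊗ (B ⊗ U)        ≈⟨ ⊗-congʳ (B ⊗ U) U⊗L≈id ⟨
  (U ⊗ L) ⊗ (B ⊗ U)    ≈⟨ ⊗-assoc U L (B ⊗ U) ⟩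
  U ⊗ (L ⊗ (B ⊗ U))    ≈⟨ ⊗-congˡ U (⊗-assoc L B U) ⟨
  U ⊗ ((L ⊗ B) ⊗ U)    ≈⟨ ⊗-congˡ U LBU≈C ⟩
  U ⊗ C                ∎
  where open MatReasoning

intertwine-^M : ∀ {n} (U B C : Mat n) → B ⊗ U ≈M U ⊗ C → ∀ k → (B ^M k) ⊗ U ≈M U ⊗ (C ^M k)
intertwine-^M U B C BU≈UC zero = ≈M-trans (⊗-identityˡ U) (≈M-sym (⊗-identityʳ U))
intertwine-^M U B C BU≈UC (suc k) = begin
  (B ⊗ (B ^M k)) ⊗ U    ≈⟨ ⊗-assoc B (B ^M k) U ⟩
  B ⊗ ((B ^M k) ⊗ U)    ≈⟨ ⊗-congˡ B (intertwine-^M U B C BU≈UC k) ⟩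
  B ⊗ (U ⊗ (C ^M k))    ≈⟨ ⊗-assoc B U (C ^M k) ⟨
  (B ⊗ U) ⊗ (C ^M k)    ≈⟨ ⊗-congʳ (C ^M k) BU≈UC ⟩
  (U ⊗ C) ⊗ (C ^M k)    ≈⟨ ⊗-assoc U C (C ^M k) ⟩
  U ⊗ (C ⊗ (C ^M k))    ∎
  where open MatReasoning

conjugate-^M : ∀ {n} (L U B C : Mat n) → L ⊗ U ≈M idM → B ⊗ U ≈M U ⊗ C →
  ∀ k → L ⊗ ((B ^M k) ⊗ U) ≈M C ^M k
conjugate-^M L U B C L⊗U≈id BU≈UC k = begin
  L ⊗ ((B ^M k) ⊗ U)    ≈⟨ ⊗-congˡ L (intertwine-^M U B C BU≈UC k) ⟩
  L ⊗ (U ⊗ (C ^M k))    ≈⟨ ⊗-assoc L U (C ^M k) ⟨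
  (L ⊗ U) ⊗ (C ^M k)    ≈⟨ ⊗-congʳ (C ^M k) L⊗U≈id ⟩
  idM ⊗ (C ^M k)        ≈⟨ ⊗-identityˡ (C ^M k) ⟩
  C ^M k                ∎
  where open MatReasoning

Wcol-conjugate : ∀ {n} (L U : Mat n) α c (G H : Graph n) → L ⊗ U ≈M idM → U ·v ones ≗ ones →
  Ac α c G ⊗ U ≈M U ⊗ Ac α c H → ∀ j → L ·v Wcol α c G j ≗ Wcol α c H j
Wcol-conjugate L U α c G H L⊗U≈id U1≗1 BU≈UC zero i = begin
  (L ·v ones) i            ≡⟨ ·v-congʳ L (λ r → ≡-sym (U1≗1 r)) i ⟩
  (L ·v (U ·v ones)) i     ≡⟨ ·v-left-inverse L U L⊗U≈id ones i ⟩
  1ℚ                       ∎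
  where open ≡-Reasoning
Wcol-conjugate L U α c G H L⊗U≈id U1≗1 BU≈UC (suc j) i = begin
  (L ·v (λ r → (Bᵏ ·v ones) r * inv c)) i            ≡⟨ ·v-congʳ L (λ r → ℚP.*-comm _ (inv c)) i ⟩
  (L ·v (λ r → inv c * (Bᵏ ·v ones) r)) i            ≡⟨ ·v-scale L (inv c) (Bᵏ ·v ones) i ⟩
  inv c * (L ·v (Bᵏ ·v ones)) i                      ≡⟨ cong (inv c *_) (·v-congʳ L (·v-congʳ Bᵏ (λ r → ≡-sym (U1≗1 r))) i) ⟩
  inv c * (L ·v (Bᵏ ·v (U ·v ones))) i               ≡⟨ cong (inv c *_) (·v-congʳ L (·v-assoc Bᵏ U ones) i) ⟩
  inv c * (L ·v ((Bᵏ ⊗ U) ·v ones)) i                ≡⟨ cong (inv c *_) (·v-assoc L (Bᵏ ⊗ U) ones i) ⟩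
  inv c * ((L ⊗ (Bᵏ ⊗ U)) ·v ones) i                 ≡⟨ cong (inv c *_) (·v-cong (conjugate-^M L U (Ac α c G) (Ac α c H) L⊗U≈id BU≈UC (suc j)) (λ _ → refl) i) ⟩
  inv c * ((Ac α c H ^M suc j) ·v ones) i            ≡⟨ ℚP.*-comm (inv c) _ ⟩
  ((Ac α c H ^M suc j) ·v ones) i * inv c            ∎
  where
  open ≡-Reasoning
  Bᵏ = Ac α c G ^M suc j

dot-cong : ∀ {n} {u u′ w w′ : Vecℚ n} → u ≗ u′ → w ≗ w′ → dot u w ≡ dot u′ w′
dot-cong {n} e e′ = Σ-cong n (λ r → cong₂ _*_ (e r) (e′ r))

dot-*ˡ : ∀ {n} c (u w : Vecℚ n) → dot (λ r → c * u r) w ≡ c * dot u w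
dot-*ˡ {n} c u w = trans (Σ-cong n (λ r → ℚP.*-assoc c (u r) (w r))) (≡-sym (Σ-*ˡ n c _))

dot-*ʳ : ∀ {n} c (u w : Vecℚ n) → dot u (λ r → c * w r) ≡ c * dot u w
dot-*ʳ {n} c u w = trans
  (Σ-cong n (λ r → solve 3 (λ a b d → a :* (b :* d) := b :* (a :* d)) refl (u r) c (w r)))
  (≡-sym (Σ-*ˡ n c _))

module _ {n : ℕ} (U : Mat n) (UᵀU≈I : (U ᵀ) ⊗ U ≈M idM) (c : ℚ) (i : Fin n) where

  private
    cUᵢ : Vecℚ n
    cUᵢ r = c * U r i

  scaled-column-quadratic : ∀ B C → B ⊗ U ≈M U ⊗ C → ∀ k →
    dot cUᵢ ((B ^M k) ·v cUᵢ) ≡ (c * c) * (C ^M k) i i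
  scaled-column-quadratic B C BU≈UC k = begin
    dot cUᵢ ((B ^M k) ·v cUᵢ)                              ≡⟨ dot-cong {u = cUᵢ} (λ _ → refl) (·v-scale (B ^M k) c Uᵢ) ⟩
    dot cUᵢ (λ r → c * ((B ^M k) ·v Uᵢ) r)                 ≡⟨ dot-*ʳ c cUᵢ ((B ^M k) ·v Uᵢ) ⟩
    c * dot cUᵢ ((B ^M k) ·v Uᵢ)                           ≡⟨ cong (c *_) (dot-*ˡ c Uᵢ ((B ^M k) ·v Uᵢ)) ⟩
    c * (c * ((U ᵀ) ⊗ ((B ^M k) ⊗ U)) i i)                 ≡⟨ ≡-sym (ℚP.*-assoc c c _) ⟩
    (c * c) * ((U ᵀ) ⊗ ((B ^M k) ⊗ U)) i i                 ≡⟨ cong ((c * c) *_) (conjugate-^M (U ᵀ) U B C UᵀU≈I BU≈UC k i i) ⟩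
    (c * c) * (C ^M k) i i                                 ∎
    where
    open ≡-Reasoning
    Uᵢ : Vecℚ n
    Uᵢ r = U r i

  Wcol-dot-scaled-column : ∀ α c′ (G H : Graph n) → U ·v ones ≗ ones → Ac α c′ G ⊗ U ≈M U ⊗ Ac α c′ H →
    ∀ j → dot (Wcol α c′ G j) cUᵢ ≡ c * Wcol α c′ H j i
  Wcol-dot-scaled-column α c′ G H U1≗1 BU≈UC j = begin
    dot (Wcol α c′ G j) cUᵢ                  ≡⟨ dot-*ʳ c (Wcol α c′ G j) (λ r → U r i) ⟩
    c * dot (Wcol α c′ G j) (λ r → U r i)    ≡⟨ cong (c *_) (Σ-cong n (λ r → ℚP.*-comm (Wcol α c′ G j r) (U r i))) ⟩
    c * ((U ᵀ) ·v Wcol α c′ G j) i           ≡⟨ cong (c *_) (Wcol-conjugate (U ᵀ) U α c′ G H UᵀU≈I U1≗1 BU≈UC j i) ⟩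
    c * Wcol α c′ H j i                      ∎
    where open ≡-Reasoning

∣ℚ-multiple : ∀ {m l x y} → m ∣ l → IsInt x → y ≡ ιℕ l * x → m ∣ℚ y
∣ℚ-multiple {m} (ℕD.divides q refl) (z , refl) refl = + q ℤ.* z , (begin
  ιℕ (q ℕ.* m) * ι z         ≡⟨ cong (_* ι z) (ιℕ-* q m) ⟩
  ιℕ q * ιℕ m * ι z          ≡⟨ solve 3 (λ a b d → a :* b :* d := b :* (a :* d)) refl (ιℕ q) (ιℕ m) (ι z) ⟩
  ιℕ m * (ιℕ q * ι z)        ≡⟨ cong (ιℕ m *_) (≡-sym (ι-* (+ q) z)) ⟩
  ιℕ m * ι (+ q ℤ.* z)       ∎)
  where open ≡-Reasoning

∣⇒^2∣* : ∀ {m l} → m ∣ l → m ^ 2 ∣ l ℕ.* l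
∣⇒^2∣* {m} {l} m∣l = subst (_∣ l ℕ.* l) (cong (m ℕ.*_) (≡-sym (ℕP.*-identityʳ m))) (ℕD.*-pres-∣ m∣l m∣l)

integer-entry : ∀ {n} {M : Mat n} → IsIntMat M → Fin n → Fin n → ℤ
integer-entry M-int r i = proj₁ (M-int r i)

module _ {n : ℕ} {U : Mat n} {l p : ℕ} (level : IsLevel U l) (p-prime : Prime p) (p∣l : p ∣ l) where

  private
    lU-int = proj₁ (proj₂ level)
    Z = integer-entry lU-int

  level-entries-not-all-divisible : ¬ (∀ r i → (+ p) ∣ℤ Z r i)
  level-entries-not-all-divisible all-divisible = ℕP.<⇒≱ q<l (proj₂ (proj₂ level) q q≥1 qU-int)
    where
    q = ℕD.quotient p∣l
    l≡qp : l ≡ q ℕ.* p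
    l≡qp = ℕD._∣_.equality p∣l
    p>1 : 1 ℕ.< p
    p>1 = ℕ.nonTrivial⇒n>1 p {{prime⇒nonTrivial p-prime}}
    p≢0 : ¬ (ιℕ p ≡ 0ℚ)
    p≢0 e = ℕP.<⇒≢ (ℕP.<-trans ℕP.0<1+n p>1) (≡-sym (cong ℤ.∣_∣ (ι-injective {+ p} {+ 0} e)))
    q≥1 : 1 ℕ.≤ q
    q≥1 = ℕP.n≢0⇒n>0 (λ q≡0 → ℕP.<⇒≢ (proj₁ level) (≡-sym (trans l≡qp (cong (ℕ._* p) q≡0))))
    q<l : q ℕ.< l
    q<l = subst (q ℕ.<_) (≡-sym l≡qp) (ℕP.m<m*n q p {{ℕ.>-nonZero q≥1}} p>1)
    qU-int : IsIntMat (scaleM (ιℕ q) U)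
    qU-int r i with ℤS.∣ᵤ⇒∣ {+ p} {Z r i} (all-divisible r i)
    ... | ℤS.divides s Z≡sp = s , *-cancelʳ p≢0 (begin
      ιℕ q * U r i * ιℕ p      ≡⟨ solve 3 (λ a b d → a :* b :* d := a :* d :* b) refl (ιℕ q) (U r i) (ιℕ p) ⟩
      ιℕ q * ιℕ p * U r i      ≡⟨ cong (_* U r i) (≡-sym (trans (cong ιℕ l≡qp) (ιℕ-* q p))) ⟩
      ιℕ l * U r i             ≡⟨ proj₂ (lU-int r i) ⟩
      ι (Z r i)                ≡⟨ cong ι Z≡sp ⟩
      ι (s ℤ.* + p)            ≡⟨ ι-* s (+ p) ⟩
      ι s * ιℕ p               ∎)
      where open ≡-Reasoning

  level-entry-not-divisible : ∃ λ i → ∃ λ r → ¬ ((+ p) ∣ℤ Z r i)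
  level-entry-not-divisible =
    let (i , column-not-divisible) = FinP.¬∀⟶∃¬ n _ (λ i → FinP.all? (λ r → divisible? r i))
                                        (λ h → level-entries-not-all-divisible (λ r i → h i r))
    in  i , FinP.¬∀⟶∃¬ n _ (λ r → divisible? r i) column-not-divisible
    where
    divisible? : ∀ r i → Dec ((+ p) ∣ℤ Z r i)
    divisible? r i = p ℕD.∣? ℤ.∣ Z r i ∣

lemma3p5 : ∀ {n : ℕ} (G : Graph n) → Connected G →
    (α : ℚ) → 0ℚ ≤ℚ α → α <ℚ 1ℚ →
    (c : ℕ) → IsCα α c →
    (U : Mat n) → IsOrthogonal U → U ·v ones ≡ ones →
    (∃ λ (H : Graph n) → ((U ᵀ) ⊗ Ac α c G) ⊗ U ≡ Ac α c H) →
    (l : ℕ) → IsLevel U l →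
    (p : ℕ) → Prime p → p ∣ l →
    (k : ℕ) →
    ∃ λ (v : Fin n → ℤ) →
    (∃ λ (i : Fin n) → ¬ ((+ p) ∣ℤ v i)) ×
    ((p ^ 2) ∣ℚ dot (toℚv v) ((Ac α c G ^M k) ·v toℚv v)) ×
    (∀ (j : ℕ) → j < n → p ∣ℚ dot (Wcol α c G j) (toℚv v))
lemma3p5 {n} G _ α _ _ c c-is-cα U UᵀU≡I U1≡1 (H , conjugate) l level p p-prime p∣l k =
  v , (r₀ , p∤v) , quadratic-form-divisible , W-orthogonal
  where
  B = Ac α c G
  C = Ac α c H
  UᵀU≈I = ≡⇒≈M UᵀU≡I
  BU≈UC = conjugate⇒intertwine (U ᵀ) U B C (left-inverse⇒right-inverse (U ᵀ) U UᵀU≈I) (≡⇒≈M conjugate)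
  entry = level-entry-not-divisible level p-prime p∣l
  i₀ = proj₁ entry
  r₀ = proj₁ (proj₂ entry)
  p∤v = proj₂ (proj₂ entry)
  v : Fin n → ℤ
  v r = integer-entry (proj₁ (proj₂ level)) r i₀
  v≗lU : toℚv v ≗ λ r → ιℕ l * U r i₀
  v≗lU r = ≡-sym (proj₂ (proj₁ (proj₂ level) r i₀))
  quadratic-form-divisible : (p ^ 2) ∣ℚ dot (toℚv v) ((B ^M k) ·v toℚv v)
  quadratic-form-divisible = ∣ℚ-multiple (∣⇒^2∣* p∣l) (IsIntMat-^M (Ac-integral c-is-cα H) k i₀ i₀)
    (trans (dot-cong v≗lU (·v-congʳ (B ^M k) v≗lU))
    (trans (scaled-column-quadratic U UᵀU≈I (ιℕ l) i₀ B C BU≈UC k) (cong (_* (C ^M k) i₀ i₀) (≡-sym (ιℕ-* l l)))))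
  W-orthogonal : ∀ j → j < n → p ∣ℚ dot (Wcol α c G j) (toℚv v)
  W-orthogonal j _ = ∣ℚ-multiple p∣l (Wcol-integral c-is-cα H j i₀)
    (trans (dot-cong {u = Wcol α c G j} (λ _ → refl) v≗lU)
           (Wcol-dot-scaled-column U UᵀU≈I (ιℕ l) i₀ α c G H (λ r → cong (λ u → u r) U1≡1) BU≈UC j))
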